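{- For each permutation $w\in\mathbf{S}_n$, we have \[ \sum_{k=0}^{n(n-1)/2}(-1)^k |\mathrm{PD}_k(w)|=1. \]
   Context: $\mathbf{S}_n$ is the symmetric group on $n$ letters. A pipe dream is an $n\times n$ square filled with crosses and elbows, all crosses strictly above the antidiagonal; it is viewed as a configuration of $n$ strands joining the left edge to the top edge, and it is reduced if every pair of strands crosses at most once. The reduction $\mathrm{reduct}(P)$ of a pipe dream $P$ is obtained by reading the rows from top to bottom, each row from right to left, and replacing by an elbow every cross where two strands that have already crossed before cross again. The shape of a reduced pipe dream is the permutation given by its strands; the shape of an arbitrary pipe dream $P$ is the shape of $\mathrm{reduct}(P)$. $D_P$ denotes the set of coordinates of crosses of $P$, and the excess of $P$ is $\mathrm{ex}(P)=\#(D_P\smallsetminus D_{\mathrm{reduct}(P)})$. $\mathrm{PD}(w)$ is the set of all (possibly non-reduced) pipe dreams of shape $w$, and $\mathrm{PD}_k(w)=\{P\in\mathrm{PD}(w)\mid \mathrm{ex}(P)=k\}$. -}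

module Defs where

open import Data.Bool using (Bool; true; false; if_then_else_; _∧_; _∨_; not)
open import Data.Nat using (ℕ; zero; suc; _+_; _*_; _∸_)
open import Data.Nat.DivMod using (_/_)
open import Data.Fin using (Fin)
open import Data.Fin.Properties using () renaming (_≟_ to _≟ᶠ_)
open import Data.Fin.Permutation using (Permutation′; _⟨$⟩ʳ_)
open import Data.Integer using (ℤ; +_; -1ℤ; _^_) renaming (_*_ to _*ℤ_; _+_ to _+ℤ_)
open import Data.List using (List; []; _∷_; [_]; map; _++_; concatMap; length; filter; foldr; upTo)
open import Data.Vec using (Vec; []; _∷_; allFin; tabulate)
open import Data.Vec.Properties using (≡-dec)
open import Data.Product using (_×_; _,_)
open import Data.Unit using (⊤; tt)
open import Relation.Nullary.Decidable using (⌊_⌋; _×-dec_)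
open import Relation.Binary.PropositionalEquality using (_≡_)
import Data.Nat.Properties as ℕP

-- Conventions: rows i = 0..n-1 (top to bottom), columns j = 0..n-1 (left to right).
-- Crosses may only occur in cells (i , j) with i + j < n - 1 (strictly above
-- the antidiagonal); all other cells are elbows.
-- Row i of the staircase has n - 1 - i cells (j = 0 .. n-2-i).

Rows : ℕ → Set
Rows zero    = ⊤
Rows (suc m) = Vec Bool m × Rows m

-- A pipe dream in the n × n square: true = cross, false = elbow.
PipeDream : ℕ → Set
PipeDream n = Rows n

-- Set of strand pairs that have already crossed.
Crossed : ℕ → Set
Crossed n = List (Fin n × Fin n)

hasCrossed : ∀ {n} → Fin n → Fin n → Crossed n → Bool
hasCrossed a b []              = false
hasCrossed a b ((c , d) ∷ cr)  =
  (⌊ a ≟ᶠ c ⌋ ∧ ⌊ b ≟ᶠ d ⌋) ∨ (⌊ a ≟ᶠ d ⌋ ∧ ⌊ b ≟ᶠ c ⌋) ∨ hasCrossed a b cr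

-- Strands are traced from the top edge (labelled by their top column) downwards/leftwards;
-- the reading order (rows top to bottom, each row right to left) is compatible with
-- this flow.  At a cell, the strand coming from the top is 'top', from the right 'right'.
-- A cross sends top→bottom and right→left; an elbow sends top→left and right→bottom.
-- If 'reducing' is true, a cross between strands that have already crossed is replaced
-- by an elbow (this is the reduction procedure); otherwise crosses are always crosses.
-- processRow bits col cr: bits = cells j = 0..m-1 of the row, col = labels of strands
-- entering from the top in columns 0..m (column m is the antidiagonal elbow cell, whose
-- top strand goes left, i.e. starts the horizontal strand).  Returns the strand leaving
-- to the left edge, the strands leaving downward in columns 0..m-1, the new row, and
-- the updated crossed set.  Cells further right are processed first.
processRow : ∀ {n m} → Bool → Vec Bool m → Vec (Fin n) (suc m) → Crossed n →
             Fin n × Vec (Fin n) m × Vec Bool m × Crossed n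
processRow red [] (c ∷ []) cr = c , [] , [] , cr
processRow red (b ∷ bs) (top ∷ cs) cr with processRow red bs cs cr
... | right , cs′ , bs′ , cr′ =
  if b ∧ not (red ∧ hasCrossed top right cr′)
  then (right , top ∷ cs′ , true ∷ bs′ , (top , right) ∷ cr′)
  else (top , right ∷ cs′ , false ∷ bs′ , cr′)

processRows : ∀ {n k} → Bool → Rows k → Vec (Fin n) k → Crossed n →
              Vec (Fin n) k × Rows k × Crossed n
processRows {k = zero} red tt [] cr = [] , tt , cr
processRows {k = suc m} red (bits , rest) col cr with processRow red bits col cr
... | h , col′ , bits′ , cr′ with processRows red rest col′ cr′
... | hs , rest′ , cr″ = h ∷ hs , (bits′ , rest′) , cr″

reduct : ∀ {n} → PipeDream n → PipeDream n
reduct {n} P with processRows true P (allFin n) []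
... | _ , P′ , _ = P′

-- Strand permutation of a pipe dream: entry i = column at whose top the strand entering
-- the left edge at row i exits (this is the shape when the pipe dream is reduced).
strands : ∀ {n} → PipeDream n → Vec (Fin n) n
strands {n} P with processRows false P (allFin n) []
... | hs , _ , _ = hs

shape : ∀ {n} → PipeDream n → Vec (Fin n) n
shape P = strands (reduct P)

diffRow : ∀ {m} → Vec Bool m → Vec Bool m → ℕ
diffRow [] [] = 0
diffRow (true ∷ xs)  (false ∷ ys) = suc (diffRow xs ys)
diffRow (_ ∷ xs)     (_ ∷ ys)     = diffRow xs ys

diffRows : ∀ {k} → Rows k → Rows k → ℕ
diffRows {zero} tt tt = 0
diffRows {suc m} (r , rs) (r′ , rs′) = diffRow r r′ + diffRows rs rs′

excess : ∀ {n} → PipeDream n → ℕ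
excess P = diffRows P (reduct P)

allVecs : (m : ℕ) → List (Vec Bool m)
allVecs zero    = [ [] ]
allVecs (suc m) = map (true ∷_) (allVecs m) ++ map (false ∷_) (allVecs m)

allRows : (k : ℕ) → List (Rows k)
allRows zero    = [ tt ]
allRows (suc m) = concatMap (λ v → map (v ,_) (allRows m)) (allVecs m)

oneLine : ∀ {n} → Permutation′ n → Vec (Fin n) n
oneLine w = tabulate (w ⟨$⟩ʳ_)

numPD : (n : ℕ) → Permutation′ n → ℕ → ℕ
numPD n w k =
  length (filter (λ P → ≡-dec _≟ᶠ_ (shape P) (oneLine w) ×-dec ℕP._≟_ (excess P) k) (allRows n))

alternatingSum : (n : ℕ) → Permutation′ n → ℤ
alternatingSum n w =
  foldr _+ℤ_ (+ 0) (map (λ k → (-1ℤ ^ k) *ℤ (+ numPD n w k)) (upTo (suc (n * (n ∸ 1) / 2))))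

-- Weight a pipe dream P with target shape t by (-1)^ex(P) and sum over P, reading the cells
-- in the order of the reduction.  At a cell where two strands that have already crossed meet,
-- a cross and an elbow lead to the same reduct and differ by one in excess, so the two choices
-- cancel.  What survives is summed one row at a time, the state between two rows being the
-- sequence of strands entering the next row from the top together with the pairs that have
-- crossed.  If that sequence has an inversion, all of whose pairs have already crossed, the
-- rest of the sum vanishes.  If it is increasing and none of its strands have crossed, the
-- only rows that do not cancel consist of crosses followed by elbows; such a row sends one
-- strand to the left edge and leaves an increasing, uncrossed sequence, and since the strand
-- leaving the row must be the prescribed one, exactly one row remains.  Starting from the
-- strands 0, …, n - 1 at the top edge, the alternating sum is therefore 1.
module Submission where

open import Data.Bool using (Bool; true; false; if_then_else_; _∧_)
open import Data.Bool.Properties using (∨-zeroʳ; ∧-zeroʳ)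
open import Data.Empty using (⊥; ⊥-elim)
open import Data.Fin using (Fin) renaming (_≤_ to _≤ᶠ_; _<_ to _<ᶠ_)
open import Data.Fin.Properties using (<-irrefl) renaming (_≟_ to _≟ᶠ_)
open import Data.Fin.Permutation using (Permutation′; _⟨$⟩ʳ_; _⟨$⟩ˡ_; inverseˡ)
open import Data.Integer using (ℤ; +_; 0ℤ; 1ℤ; -1ℤ; _+_; _*_; _^_)
import Data.Integer.Properties as ℤP
open import Data.Integer.Tactic.RingSolver using (solve-∀)
open import Data.List using (List; []; _∷_; [_]; _++_; map; concatMap; foldr; filter; length; upTo)
import Data.List as List
open import Data.List.Properties using (map-cong; map-cong-local; map-∘; map-++; ++-assoc)
open import Data.List.Membership.Propositional using (_∈_; _∉_)
open import Data.List.Membership.Propositional.Properties using (∈-upTo⁺; ∈-allFin)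
open import Data.List.Relation.Unary.All as All using (All; []; _∷_)
import Data.List.Relation.Unary.All.Properties as Allₚ
open import Data.List.Relation.Unary.Any as Any using (Any; here; there)
import Data.List.Relation.Unary.Any.Properties as Anyₚ
open import Data.List.Relation.Unary.AllPairs as AllPairs using (AllPairs; []; _∷_)
import Data.List.Relation.Unary.AllPairs.Properties as AllPairsₚ
open import Data.List.Relation.Unary.Unique.Propositional using (Unique)
open import Data.List.Relation.Unary.Unique.Propositional.Properties using (upTo⁺)
open import Data.Nat as ℕ using (ℕ; zero; suc; _∸_; _≤_; _<_; z≤n; s≤s)
import Data.Nat.Properties as ℕP
open import Data.Nat.DivMod using (_/_; m*n/n≡m)
open import Data.Nat.Tactic.RingSolver using () renaming (solve-∀ to solve-∀ℕ)
open import Data.Product using (_×_; _,_; proj₁; proj₂)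
open import Data.Sum using (_⊎_; inj₁; inj₂)
open import Data.Vec using (Vec; []; _∷_; toList; allFin; tabulate)
open import Data.Vec.Properties using (≡-dec)
open import Function using (_∘_)
open import Relation.Binary.Definitions using (DecidableEquality)
open import Relation.Binary.PropositionalEquality using (_≡_; refl; sym; trans; cong; cong₂; subst; module ≡-Reasoning)
open import Relation.Nullary using (¬_; Dec; yes; no; does)
open import Relation.Nullary.Decidable using (⌊_⌋; _×-dec_; isYes≗does; dec-true; dec-false)
open import Relation.Unary using (Decidable)

open import Defs

private variable
  A B : Set

-- Sums of integers over lists

sumℤ : List ℤ → ℤ
sumℤ = foldr _+_ 0ℤ

sum-++ : ∀ xs ys → sumℤ (xs ++ ys) ≡ sumℤ xs + sumℤ ys
sum-++ []       ys = sym (ℤP.+-identityˡ _)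
sum-++ (x ∷ xs) ys = trans (cong (_+_ x) (sum-++ xs ys)) (sym (ℤP.+-assoc x _ _))

sum-map-0 : {f : A → ℤ} → (∀ x → f x ≡ 0ℤ) → ∀ xs → sumℤ (map f xs) ≡ 0ℤ
sum-map-0 f≡0 []       = refl
sum-map-0 f≡0 (x ∷ xs) = cong₂ _+_ (f≡0 x) (sum-map-0 f≡0 xs)

sum-map-+ : (f g : A → ℤ) → ∀ xs →
            sumℤ (map (λ x → f x + g x) xs) ≡ sumℤ (map f xs) + sumℤ (map g xs)
sum-map-+ f g []       = refl
sum-map-+ f g (x ∷ xs) =
  trans (cong (_+_ (f x + g x)) (sum-map-+ f g xs)) (interchange (f x) (g x) _ _)
  where
  interchange : ∀ a b c d → (a + b) + (c + d) ≡ (a + c) + (b + d)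
  interchange = solve-∀

sum-map-*ˡ : (c : ℤ) (f : A → ℤ) → ∀ xs → sumℤ (map (λ x → c * f x) xs) ≡ c * sumℤ (map f xs)
sum-map-*ˡ c f []       = sym (ℤP.*-zeroʳ c)
sum-map-*ˡ c f (x ∷ xs) =
  trans (cong (_+_ (c * f x)) (sum-map-*ˡ c f xs)) (sym (ℤP.*-distribˡ-+ c (f x) _))

sum-map-++ : (f : A → ℤ) → ∀ xs ys → sumℤ (map f (xs ++ ys)) ≡ sumℤ (map f xs) + sumℤ (map f ys)
sum-map-++ f xs ys = trans (cong sumℤ (map-++ f xs ys)) (sum-++ (map f xs) (map f ys))

sum-map-concatMap : (f : B → ℤ) (g : A → List B) → ∀ xs →
                    sumℤ (map f (concatMap g xs)) ≡ sumℤ (map (λ x → sumℤ (map f (g x))) xs)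
sum-map-concatMap f g []       = refl
sum-map-concatMap f g (x ∷ xs) =
  trans (sum-map-++ f (g x) (concatMap g xs)) (cong (_+_ (sumℤ (map f (g x)))) (sum-map-concatMap f g xs))

module _ (_≟_ : DecidableEquality A) where

  δ : A → A → ℤ
  δ a b = if does (a ≟ b) then 1ℤ else 0ℤ

  δ-refl : ∀ a → δ a a ≡ 1ℤ
  δ-refl a rewrite dec-true (a ≟ a) refl = refl

  δ-≢ : ∀ {a b} → ¬ a ≡ b → δ a b ≡ 0ℤ
  δ-≢ {a} {b} a≢b rewrite dec-false (a ≟ b) a≢b = refl

  δ-sym : ∀ a b → δ a b ≡ δ b a
  δ-sym a b with a ≟ b | b ≟ a
  ... | yes _   | yes _   = refl
  ... | no _    | no _    = refl
  ... | yes a≡b | no b≢a  = ⊥-elim (b≢a (sym a≡b))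
  ... | no a≢b  | yes b≡a = ⊥-elim (a≢b (sym b≡a))

  sum-δ-∉ : (F : A → ℤ) {e : A} → ∀ xs → e ∉ xs → sumℤ (map (λ x → F x * δ x e) xs) ≡ 0ℤ
  sum-δ-∉ F []       e∉ = refl
  sum-δ-∉ F (x ∷ xs) e∉ =
    cong₂ _+_ (trans (cong (F x *_) (δ-≢ (λ x≡e → e∉ (here (sym x≡e))))) (ℤP.*-zeroʳ (F x)))
              (sum-δ-∉ F xs (e∉ ∘ there))

  sum-δ : (F : A → ℤ) {e : A} {xs : List A} → Unique xs → e ∈ xs →
          sumℤ (map (λ x → F x * δ x e) xs) ≡ F e
  sum-δ F {xs = x ∷ xs} (x≢ ∷ _) (here refl) =
    trans (cong₂ _+_ (trans (cong (F x *_) (δ-refl x)) (ℤP.*-identityʳ (F x)))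
                     (sum-δ-∉ F xs (λ x∈xs → All.lookup x≢ x∈xs refl)))
          (ℤP.+-identityʳ (F x))
  sum-δ F {xs = x ∷ xs} (x≢ ∷ u) (there e∈xs) =
    trans (cong₂ _+_ (trans (cong (F x *_) (δ-≢ (All.lookup x≢ e∈xs))) (ℤP.*-zeroʳ (F x)))
                     (sum-δ F u e∈xs))
          (ℤP.+-identityˡ _)

length-filter-∷ : {P : A → Set} (P? : Decidable P) → ∀ x xs →
                  + length (filter P? (x ∷ xs)) ≡ (if does (P? x) then 1ℤ else 0ℤ) + + length (filter P? xs)
length-filter-∷ P? x xs with does (P? x)
... | true  = refl
... | false = refl

sign : ℕ → ℤ
sign k = -1ℤ ^ k

sum-signed-counts : {P : A → Set} (P? : Decidable P) (e : A → ℕ) (M : ℕ) →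
  (∀ x → e x < M) → (xs : List A) →
  sumℤ (map (λ k → sign k * + length (filter (λ x → P? x ×-dec (e x ℕP.≟ k)) xs)) (upTo M))
    ≡ sumℤ (map (λ x → if does (P? x) then sign (e x) else 0ℤ) xs)
sum-signed-counts P? e M e<M []       = sum-map-0 (λ k → ℤP.*-zeroʳ (sign k)) (upTo M)
sum-signed-counts P? e M e<M (x ∷ xs) = begin
    sumℤ (map (λ k → sign k * + length (filter (P∧≡ k) (x ∷ xs))) (upTo M))
  ≡⟨ cong sumℤ (map-cong split (upTo M)) ⟩
    sumℤ (map (λ k → sign k * hit k + sign k * + length (filter (P∧≡ k) xs)) (upTo M))
  ≡⟨ sum-map-+ (λ k → sign k * hit k) _ (upTo M) ⟩
    sumℤ (map (λ k → sign k * hit k) (upTo M))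
      + sumℤ (map (λ k → sign k * + length (filter (P∧≡ k) xs)) (upTo M))
  ≡⟨ cong₂ _+_ sum-hits (sum-signed-counts P? e M e<M xs) ⟩
    sumℤ (map (λ x → if does (P? x) then sign (e x) else 0ℤ) (x ∷ xs)) ∎
  where
  open ≡-Reasoning
  P∧≡ : ∀ k y → Dec (_ × e y ≡ k)
  P∧≡ k y = P? y ×-dec (e y ℕP.≟ k)
  hit : ℕ → ℤ
  hit k = if does (P? x) ∧ does (e x ℕP.≟ k) then 1ℤ else 0ℤ
  split : ∀ k → sign k * + length (filter (P∧≡ k) (x ∷ xs))
              ≡ sign k * hit k + sign k * + length (filter (P∧≡ k) xs)
  split k = trans (cong (sign k *_) (length-filter-∷ (P∧≡ k) x xs)) (ℤP.*-distribˡ-+ (sign k) _ _)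
  sum-hits : sumℤ (map (λ k → sign k * (if does (P? x) ∧ does (e x ℕP.≟ k) then 1ℤ else 0ℤ)) (upTo M))
             ≡ (if does (P? x) then sign (e x) else 0ℤ)
  sum-hits with does (P? x)
  ... | true  = trans (cong sumℤ (map-cong (λ k → cong (sign k *_) (δ-sym ℕP._≟_ (e x) k)) (upTo M)))
                      (sum-δ ℕP._≟_ sign (upTo⁺ M) (∈-upTo⁺ (e<M x)))
  ... | false = sum-map-0 (λ k → ℤP.*-zeroʳ (sign k)) (upTo M)

-- Bounding the excess

diffRow-≤ : ∀ {m} (u v : Vec Bool m) → diffRow u v ≤ m
diffRow-≤ []          []          = z≤n
diffRow-≤ (true ∷ u)  (false ∷ v) = s≤s (diffRow-≤ u v)
diffRow-≤ (true ∷ u)  (true ∷ v)  = ℕP.m≤n⇒m≤1+n (diffRow-≤ u v)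
diffRow-≤ (false ∷ u) (true ∷ v)  = ℕP.m≤n⇒m≤1+n (diffRow-≤ u v)
diffRow-≤ (false ∷ u) (false ∷ v) = ℕP.m≤n⇒m≤1+n (diffRow-≤ u v)

triangle : ℕ → ℕ
triangle zero    = 0
triangle (suc m) = m ℕ.+ triangle m

diffRows-≤ : ∀ {k} (P Q : Rows k) → diffRows P Q ≤ triangle k
diffRows-≤ {zero}  _       _       = z≤n
diffRows-≤ {suc m} (u , P) (v , Q) = ℕP.+-mono-≤ (diffRow-≤ u v) (diffRows-≤ P Q)

triangle-*2 : ∀ n → triangle n ℕ.* 2 ≡ n ℕ.* (n ∸ 1)
triangle-*2 zero          = refl
triangle-*2 (suc zero)    = refl
triangle-*2 (suc (suc m)) = begin
    (suc m ℕ.+ triangle (suc m)) ℕ.* 2        ≡⟨ ℕP.*-distribʳ-+ 2 (suc m) (triangle (suc m)) ⟩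
    suc m ℕ.* 2 ℕ.+ triangle (suc m) ℕ.* 2    ≡⟨ cong (suc m ℕ.* 2 ℕ.+_) (triangle-*2 (suc m)) ⟩
    suc m ℕ.* 2 ℕ.+ suc m ℕ.* m               ≡⟨ step m ⟩
    suc (suc m) ℕ.* suc m                      ∎
  where
  open ≡-Reasoning
  step : ∀ m → suc m ℕ.* 2 ℕ.+ suc m ℕ.* m ≡ suc (suc m) ℕ.* suc m
  step = solve-∀ℕ

triangle≡ : ∀ n → triangle n ≡ n ℕ.* (n ∸ 1) / 2
triangle≡ n = trans (sym (m*n/n≡m (triangle n) 2)) (cong (_/ 2) (triangle-*2 n))

excess< : ∀ {n} (P : PipeDream n) → excess P < suc (n ℕ.* (n ∸ 1) / 2)
excess< {n} P = s≤s (ℕP.≤-trans (diffRows-≤ P (reduct P)) (ℕP.≤-reflexive (triangle≡ n)))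

-- Reduction

module _ {n m : ℕ} (run : Fin n × Vec (Fin n) m × Vec Bool m × Crossed n) where

  leftExit : Fin n
  leftExit = proj₁ run

  downStrands : Vec (Fin n) m
  downStrands = proj₁ (proj₂ run)

  reducedRow : Vec Bool m
  reducedRow = proj₁ (proj₂ (proj₂ run))

  crossedAfter : Crossed n
  crossedAfter = proj₂ (proj₂ (proj₂ run))

processRow-reduced : ∀ {n m} (bs : Vec Bool m) (col : Vec (Fin n) (suc m)) cr →
  processRow false (reducedRow (processRow true bs col cr)) col cr ≡ processRow true bs col cr
processRow-reduced []       (c ∷ [])   cr = refl
processRow-reduced (b ∷ bs) (top ∷ cs) cr with processRow true bs cs cr | processRow-reduced bs cs cr
... | right , cs′ , bs′ , cr′ | ih with b | hasCrossed top right cr′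
... | true  | false rewrite ih = refl
... | true  | true  rewrite ih = refl
... | false | _     rewrite ih = refl

processRows-reduced : ∀ {n k} (P : Rows k) (col : Vec (Fin n) k) cr →
  processRows false (proj₁ (proj₂ (processRows true P col cr))) col cr ≡ processRows true P col cr
processRows-reduced {k = zero}  _          []  cr = refl
processRows-reduced {k = suc m} (bs , P) col cr
  with processRow true bs col cr | processRow-reduced bs col cr
... | h , col′ , bs′ , cr′ | row-eq with processRows true P col′ cr′ | processRows-reduced P col′ cr′
... | hs , P′ , cr″ | rows-eq rewrite row-eq | rows-eq = refl

reduct≡ : ∀ {n} (P : PipeDream n) → reduct P ≡ proj₁ (proj₂ (processRows true P (allFin n) []))
reduct≡ {n} P with processRows true P (allFin n) []
... | _ , _ , _ = refl

strands≡ : ∀ {n} (P : PipeDream n) → strands P ≡ proj₁ (processRows false P (allFin n) [])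
strands≡ {n} P with processRows false P (allFin n) []
... | _ , _ , _ = refl

shape≡ : ∀ {n} (P : PipeDream n) → shape P ≡ proj₁ (processRows true P (allFin n) [])
shape≡ {n} P = begin
    strands (reduct P)
  ≡⟨ strands≡ (reduct P) ⟩
    proj₁ (processRows false (reduct P) (allFin n) [])
  ≡⟨ cong (λ Q → proj₁ (processRows false Q (allFin n) [])) (reduct≡ P) ⟩
    proj₁ (processRows false (proj₁ (proj₂ (processRows true P (allFin n) []))) (allFin n) [])
  ≡⟨ cong proj₁ (processRows-reduced P (allFin n) []) ⟩
    proj₁ (processRows true P (allFin n) []) ∎
  where open ≡-Reasoning

excess≡ : ∀ {n} (P : PipeDream n) → excess P ≡ diffRows P (proj₁ (proj₂ (processRows true P (allFin n) [])))
excess≡ P = cong (diffRows P) (reduct≡ P)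

-- Signed counts, row by row

signedTerm : ∀ {n k} → Vec (Fin n) k → Crossed n → Vec (Fin n) k → Rows k → ℤ
signedTerm col cr t P = δ (≡-dec _≟ᶠ_) (proj₁ run) t * sign (diffRows P (proj₁ (proj₂ run)))
  where run = processRows true P col cr

signedCount : ∀ {n} k → Vec (Fin n) k → Crossed n → Vec (Fin n) k → ℤ
signedCount k col cr t = sumℤ (map (signedTerm col cr t) (allRows k))

Continuation : ℕ → ℕ → Set
Continuation n m = Fin n → Vec (Fin n) m → Crossed n → ℤ

rowTerm : ∀ {n m} → Vec (Fin n) (suc m) → Crossed n → Continuation n m → Vec Bool m → ℤ
rowTerm col cr G bs =
  sign (diffRow bs (reducedRow run)) * G (leftExit run) (downStrands run) (crossedAfter run)
  where run = processRow true bs col cr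

rowSum : ∀ {n m} → Vec (Fin n) (suc m) → Crossed n → Continuation n m → ℤ
rowSum {m = m} col cr G = sumℤ (map (rowTerm col cr G) (allVecs m))

-- Reads the leftmost cell of a row, entered by top from above and by right from the rest of the row.
leftCell : ∀ {n m} → Fin n → Continuation n (suc m) → Continuation n m
leftCell top G right d c =
  if hasCrossed top right c then 0ℤ else (G right (top ∷ d) ((top , right) ∷ c) + G top (right ∷ d) c)

-- If top and right have already crossed, the reduct has an elbow at this cell whatever P has
-- there, so the two choices differ only by one in the excess.
rowTerm-leftCell : ∀ {n m} (top : Fin n) (cs : Vec (Fin n) (suc m)) cr (G : Continuation n (suc m)) bs →
  rowTerm (top ∷ cs) cr G (true ∷ bs) + rowTerm (top ∷ cs) cr G (false ∷ bs)
    ≡ rowTerm cs cr (leftCell top G) bs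
rowTerm-leftCell top cs cr G bs with processRow true bs cs cr
... | right , cs′ , bs′ , cr′ with hasCrossed top right cr′
... | true  = cancel (sign (diffRow bs bs′)) (G top (right ∷ cs′) cr′)
  where
  cancel : ∀ s x → (-1ℤ * s) * x + s * x ≡ s * 0ℤ
  cancel = solve-∀
... | false = sym (ℤP.*-distribˡ-+ (sign (diffRow bs bs′)) _ _)

rowSum-leftCell : ∀ {n m} (top : Fin n) (cs : Vec (Fin n) (suc m)) cr (G : Continuation n (suc m)) →
                  rowSum (top ∷ cs) cr G ≡ rowSum cs cr (leftCell top G)
rowSum-leftCell {m = m} top cs cr G = begin
    sumℤ (map T (map (true ∷_) V ++ map (false ∷_) V))
  ≡⟨ sum-map-++ T (map (true ∷_) V) (map (false ∷_) V) ⟩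
    sumℤ (map T (map (true ∷_) V)) + sumℤ (map T (map (false ∷_) V))
  ≡⟨ sym (cong₂ _+_ (cong sumℤ (map-∘ V)) (cong sumℤ (map-∘ V))) ⟩
    sumℤ (map (T ∘ (true ∷_)) V) + sumℤ (map (T ∘ (false ∷_)) V)
  ≡⟨ sym (sum-map-+ (T ∘ (true ∷_)) (T ∘ (false ∷_)) V) ⟩
    sumℤ (map (λ bs → T (true ∷ bs) + T (false ∷ bs)) V)
  ≡⟨ cong sumℤ (map-cong (rowTerm-leftCell top cs cr G) V) ⟩
    rowSum cs cr (leftCell top G) ∎
  where
  open ≡-Reasoning
  V = allVecs m
  T = rowTerm (top ∷ cs) cr G

δ-∷ : ∀ {n k} (h t₀ : Fin n) (hs ts : Vec (Fin n) k) →
      δ (≡-dec _≟ᶠ_) (h ∷ hs) (t₀ ∷ ts) ≡ δ _≟ᶠ_ h t₀ * δ (≡-dec _≟ᶠ_) hs ts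
δ-∷ h t₀ hs ts with h ≟ᶠ t₀ | ≡-dec _≟ᶠ_ hs ts
... | yes _ | yes _ = refl
... | yes _ | no _  = refl
... | no _  | yes _ = refl
... | no _  | no _  = refl

signedTerm-∷ : ∀ {n m} (col : Vec (Fin n) (suc m)) cr t₀ ts bs P →
  let run = processRow true bs col cr in
  signedTerm col cr (t₀ ∷ ts) (bs , P)
    ≡ (δ _≟ᶠ_ (leftExit run) t₀ * sign (diffRow bs (reducedRow run)))
        * signedTerm (downStrands run) (crossedAfter run) ts P
signedTerm-∷ col cr t₀ ts bs P with processRow true bs col cr
... | h , col′ , bs′ , cr′ with processRows true P col′ cr′
... | hs , P′ , cr″ = begin
    δ (≡-dec _≟ᶠ_) (h ∷ hs) (t₀ ∷ ts) * sign (diffRow bs bs′ ℕ.+ diffRows P P′)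
  ≡⟨ cong₂ _*_ (δ-∷ h t₀ hs ts) (ℤP.^-distribˡ-+-* -1ℤ (diffRow bs bs′) (diffRows P P′)) ⟩
    (δ _≟ᶠ_ h t₀ * δ (≡-dec _≟ᶠ_) hs ts) * (sign (diffRow bs bs′) * sign (diffRows P P′))
  ≡⟨ interchange (δ _≟ᶠ_ h t₀) _ (sign (diffRow bs bs′)) _ ⟩
    (δ _≟ᶠ_ h t₀ * sign (diffRow bs bs′)) * (δ (≡-dec _≟ᶠ_) hs ts * sign (diffRows P P′)) ∎
  where
  open ≡-Reasoning
  interchange : ∀ a b c d → (a * b) * (c * d) ≡ (a * c) * (b * d)
  interchange = solve-∀

signedCount-∷ : ∀ {n m} (col : Vec (Fin n) (suc m)) cr t₀ ts →
  signedCount (suc m) col cr (t₀ ∷ ts) ≡ rowSum col cr (λ h d c → δ _≟ᶠ_ h t₀ * signedCount m d c ts)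
signedCount-∷ {m = m} col cr t₀ ts = begin
    sumℤ (map (signedTerm col cr (t₀ ∷ ts)) (concatMap (λ bs → map (bs ,_) (allRows m)) (allVecs m)))
  ≡⟨ sum-map-concatMap (signedTerm col cr (t₀ ∷ ts)) (λ bs → map (bs ,_) (allRows m)) (allVecs m) ⟩
    sumℤ (map (λ bs → sumℤ (map (signedTerm col cr (t₀ ∷ ts)) (map (bs ,_) (allRows m)))) (allVecs m))
  ≡⟨ cong sumℤ (map-cong row (allVecs m)) ⟩
    rowSum col cr G ∎
  where
  open ≡-Reasoning
  G : Continuation _ m
  G h d c = δ _≟ᶠ_ h t₀ * signedCount m d c ts
  row : ∀ bs → sumℤ (map (signedTerm col cr (t₀ ∷ ts)) (map (bs ,_) (allRows m))) ≡ rowTerm col cr G bs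
  row bs = begin
      sumℤ (map (signedTerm col cr (t₀ ∷ ts)) (map (bs ,_) (allRows m)))
    ≡⟨ cong sumℤ (sym (map-∘ (allRows m))) ⟩
      sumℤ (map (λ P → signedTerm col cr (t₀ ∷ ts) (bs , P)) (allRows m))
    ≡⟨ cong sumℤ (map-cong (signedTerm-∷ col cr t₀ ts bs) (allRows m)) ⟩
      sumℤ (map (λ P → (δₕ * s) * signedTerm (downStrands run) (crossedAfter run) ts P) (allRows m))
    ≡⟨ sum-map-*ˡ (δₕ * s) (signedTerm (downStrands run) (crossedAfter run) ts) (allRows m) ⟩
      (δₕ * s) * signedCount m (downStrands run) (crossedAfter run) ts
    ≡⟨ reassoc δₕ s _ ⟩
      rowTerm col cr G bs ∎
    where
    run = processRow true bs col cr
    δₕ = δ _≟ᶠ_ (leftExit run) t₀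
    s = sign (diffRow bs (reducedRow run))
    reassoc : ∀ a b c → (a * b) * c ≡ b * (a * c)
    reassoc = solve-∀

-- Inversions and crossed pairs

AllPairs-++⁻ʳ : {R : A → A → Set} (xs : List A) {ys : List A} → AllPairs R (xs ++ ys) → AllPairs R ys
AllPairs-++⁻ʳ []       rs       = rs
AllPairs-++⁻ʳ (x ∷ xs) (_ ∷ rs) = AllPairs-++⁻ʳ xs rs

AllPairs-adjacent : {R : A → A → Set} (xs : List A) {a b : A} {ys : List A} →
                    AllPairs R (xs ++ a ∷ b ∷ ys) → R a b
AllPairs-adjacent []       ((rab ∷ _) ∷ _) = rab
AllPairs-adjacent (x ∷ xs) (_ ∷ rs)        = AllPairs-adjacent xs rs

AllPairs-map-All : {P : A → Set} {R S : A → A → Set} →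
  (∀ {a b} → P a → P b → R a b → S a b) → ∀ {xs} → All P xs → AllPairs R xs → AllPairs S xs
AllPairs-map-All f []         []         = []
AllPairs-map-All f (pa ∷ pas) (ra ∷ ras) =
  All.zipWith (λ (pb , r) → f pa pb r) (pas , ra) ∷ AllPairs-map-All f pas ras

All-swap-adjacent : {P : A → Set} (xs : List A) {a b : A} {ys : List A} →
                    All P (xs ++ a ∷ b ∷ ys) → All P (xs ++ b ∷ a ∷ ys)
All-swap-adjacent []       (pa ∷ pb ∷ ps) = pb ∷ pa ∷ ps
All-swap-adjacent (x ∷ xs) (px ∷ ps)      = px ∷ All-swap-adjacent xs ps

-- Repeated entries count as inversions.
HasInversion : ∀ {n} → List (Fin n) → Set
HasInversion []       = ⊥
HasInversion (x ∷ xs) = Any (_≤ᶠ x) xs ⊎ HasInversion xs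

InversionAcross : ∀ {n} → List (Fin n) → List (Fin n) → Set
InversionAcross xs ys = Any (λ x → Any (_≤ᶠ x) ys) xs

¬HasInversion-[_] : ∀ {n} (r : Fin n) → ¬ HasInversion [ r ]
¬HasInversion-[ r ] (inj₁ ())
¬HasInversion-[ r ] (inj₂ ())

HasInversion-++ˡ : ∀ {n} (xs ys : List (Fin n)) → HasInversion xs → HasInversion (xs ++ ys)
HasInversion-++ˡ (x ∷ xs) ys (inj₁ y≤x) = inj₁ (Anyₚ.++⁺ˡ y≤x)
HasInversion-++ˡ (x ∷ xs) ys (inj₂ inv) = inj₂ (HasInversion-++ˡ xs ys inv)

HasInversion-++ʳ : ∀ {n} (xs ys : List (Fin n)) → HasInversion ys → HasInversion (xs ++ ys)
HasInversion-++ʳ []       ys inv = inv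
HasInversion-++ʳ (x ∷ xs) ys inv = inj₂ (HasInversion-++ʳ xs ys inv)

InversionAcross⇒HasInversion : ∀ {n} (xs ys : List (Fin n)) → InversionAcross xs ys → HasInversion (xs ++ ys)
InversionAcross⇒HasInversion (x ∷ xs) ys (here y≤x) = inj₁ (Anyₚ.++⁺ʳ xs y≤x)
InversionAcross⇒HasInversion (x ∷ xs) ys (there i)  = inj₂ (InversionAcross⇒HasInversion xs ys i)

HasInversion-++⁻ : ∀ {n} (xs ys : List (Fin n)) → HasInversion (xs ++ ys) →
                   HasInversion xs ⊎ HasInversion ys ⊎ InversionAcross xs ys
HasInversion-++⁻ []       ys inv = inj₂ (inj₁ inv)
HasInversion-++⁻ (x ∷ xs) ys (inj₁ y≤x) with Anyₚ.++⁻ xs y≤x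
... | inj₁ inxs = inj₁ (inj₁ inxs)
... | inj₂ inys = inj₂ (inj₂ (here inys))
HasInversion-++⁻ (x ∷ xs) ys (inj₂ inv) with HasInversion-++⁻ xs ys inv
... | inj₁ i         = inj₁ (inj₂ i)
... | inj₂ (inj₁ i)  = inj₂ (inj₁ i)
... | inj₂ (inj₂ i)  = inj₂ (inj₂ (there i))

-- Invariant of the vanishing argument: pre are the top strands of the cells still to be read
-- (left of the current position), r the strand travelling left and d the strands sent down.
ForcesInversion : ∀ {n m} → List (Fin n) → Fin n → Vec (Fin n) m → Set
ForcesInversion pre r d = HasInversion (pre ++ [ r ]) ⊎ HasInversion (pre ++ toList d)

ForcesInversion-cross : ∀ {n m} pre (top r : Fin n) (d : Vec (Fin n) m) → top <ᶠ r →
                        ForcesInversion (pre ++ [ top ]) r d → ForcesInversion pre r (top ∷ d)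
ForcesInversion-cross pre top r d top<r (inj₁ inv) with HasInversion-++⁻ (pre ++ [ top ]) [ r ] inv
... | inj₂ (inj₁ i) = ⊥-elim (¬HasInversion-[ r ] i)
... | inj₂ (inj₂ i) with Anyₚ.++⁻ pre i
...   | inj₁ i′ = inj₁ (InversionAcross⇒HasInversion pre [ r ] i′)
...   | inj₂ (here (here r≤top)) = ⊥-elim (ℕP.<⇒≱ top<r r≤top)
ForcesInversion-cross pre top r d top<r (inj₁ inv) | inj₁ i with HasInversion-++⁻ pre [ top ] i
...   | inj₁ i′         = inj₂ (HasInversion-++ˡ pre (top ∷ toList d) i′)
...   | inj₂ (inj₁ i′)  = ⊥-elim (¬HasInversion-[ top ] i′)
...   | inj₂ (inj₂ i′)  = inj₂ (InversionAcross⇒HasInversion pre (top ∷ toList d) (Any.map Anyₚ.++⁺ˡ i′))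
ForcesInversion-cross pre top r d top<r (inj₂ inv) =
  inj₂ (subst HasInversion (++-assoc pre [ top ] (toList d)) inv)

ForcesInversion-elbow : ∀ {n m} pre (top r : Fin n) (d : Vec (Fin n) m) → top <ᶠ r →
                        ForcesInversion (pre ++ [ top ]) r d → ForcesInversion pre top (r ∷ d)
ForcesInversion-elbow pre top r d top<r (inj₁ inv) with HasInversion-++⁻ (pre ++ [ top ]) [ r ] inv
... | inj₁ i        = inj₁ i
... | inj₂ (inj₁ i) = ⊥-elim (¬HasInversion-[ r ] i)
... | inj₂ (inj₂ i) with Anyₚ.++⁻ pre i
...   | inj₁ i′ = inj₂ (InversionAcross⇒HasInversion pre (r ∷ toList d) (Any.map Anyₚ.++⁺ˡ i′))
...   | inj₂ (here (here r≤top)) = ⊥-elim (ℕP.<⇒≱ top<r r≤top)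
ForcesInversion-elbow pre top r d top<r (inj₂ inv) with HasInversion-++⁻ (pre ++ [ top ]) (toList d) inv
... | inj₁ i        = inj₁ i
... | inj₂ (inj₁ i) = inj₂ (HasInversion-++ʳ pre (r ∷ toList d) (inj₂ i))
... | inj₂ (inj₂ i) with Anyₚ.++⁻ pre i
...   | inj₁ i′ = inj₂ (InversionAcross⇒HasInversion pre (r ∷ toList d) (Any.map there i′))
...   | inj₂ (here y≤top) =
  inj₂ (HasInversion-++ʳ pre (r ∷ toList d)
          (inj₁ (Any.map (λ y≤top → ℕP.<⇒≤ (ℕP.≤-<-trans y≤top top<r)) y≤top)))

isYes-true : {P : Set} (p? : Dec P) → P → ⌊ p? ⌋ ≡ true
isYes-true p? p = trans (isYes≗does p?) (dec-true p? p)

isYes-false : {P : Set} (p? : Dec P) → ¬ P → ⌊ p? ⌋ ≡ false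
isYes-false p? ¬p = trans (isYes≗does p?) (dec-false p? ¬p)

hasCrossed-∷ : ∀ {n} {x y : Fin n} p c → hasCrossed x y c ≡ true → hasCrossed x y (p ∷ c) ≡ true
hasCrossed-∷ {x = x} {y} (a , b) c crossed
  rewrite crossed | ∨-zeroʳ (⌊ x ≟ᶠ b ⌋ ∧ ⌊ y ≟ᶠ a ⌋) = ∨-zeroʳ _

hasCrossed-head : ∀ {n} (a b : Fin n) c → hasCrossed b a ((a , b) ∷ c) ≡ true
hasCrossed-head a b c rewrite isYes-true (b ≟ᶠ b) refl | isYes-true (a ≟ᶠ a) refl = ∨-zeroʳ _

hasCrossed-∷-≢ : ∀ {n} {x a b : Fin n} y c → ¬ x ≡ a → ¬ x ≡ b →
                 hasCrossed x y ((a , b) ∷ c) ≡ hasCrossed x y c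
hasCrossed-∷-≢ {x = x} {a} {b} y c x≢a x≢b
  rewrite isYes-false (x ≟ᶠ a) x≢a | isYes-false (x ≟ᶠ b) x≢b = refl

hasCrossed-∷-≢snd : ∀ {n} {x y a b : Fin n} c → ¬ y ≡ b → ¬ x ≡ b →
                    hasCrossed x y ((a , b) ∷ c) ≡ hasCrossed x y c
hasCrossed-∷-≢snd {x = x} {y} {a} {b} c y≢b x≢b
  rewrite isYes-false (y ≟ᶠ b) y≢b | isYes-false (x ≟ᶠ b) x≢b | ∧-zeroʳ ⌊ x ≟ᶠ a ⌋ = refl

CrossedIfInverted : ∀ {n} → Crossed n → Fin n → Fin n → Set
CrossedIfInverted c x y = y ≤ᶠ x → hasCrossed x y c ≡ true

InversionsCrossed : ∀ {n} → Crossed n → List (Fin n) → Set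
InversionsCrossed c = AllPairs (CrossedIfInverted c)

Sorted : ∀ {n} → List (Fin n) → Set
Sorted = AllPairs _<ᶠ_

Uncrossed : ∀ {n} → Crossed n → List (Fin n) → Set
Uncrossed c = AllPairs (λ x y → hasCrossed x y c ≡ false)

Sorted⇒InversionsCrossed : ∀ {n} c {xs : List (Fin n)} → Sorted xs → InversionsCrossed c xs
Sorted⇒InversionsCrossed c = AllPairs.map (λ x<y y≤x → ⊥-elim (ℕP.<⇒≱ x<y y≤x))

Sorted⇒Unique : ∀ {n} {xs : List (Fin n)} → Sorted xs → Unique xs
Sorted⇒Unique = AllPairs.map (λ x<y x≡y → <-irrefl x≡y x<y)

crossedIfInverted-∷ : ∀ {n} {x y : Fin n} p c → CrossedIfInverted c x y → CrossedIfInverted (p ∷ c) x y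
crossedIfInverted-∷ p c crossed y≤x = hasCrossed-∷ p c (crossed y≤x)

InversionsCrossed-cross : ∀ {n} pre (top r : Fin n) ys c →
  InversionsCrossed c (pre ++ top ∷ r ∷ ys) → InversionsCrossed ((top , r) ∷ c) (pre ++ r ∷ top ∷ ys)
InversionsCrossed-cross [] top r ys c ((top-r ∷ top-ys) ∷ (r-ys ∷ ys-ok)) =
  ((λ _ → hasCrossed-head top r c) ∷ All.map (crossedIfInverted-∷ _ c) r-ys)
  ∷ All.map (crossedIfInverted-∷ _ c) top-ys
  ∷ AllPairs.map (crossedIfInverted-∷ _ c) ys-ok
InversionsCrossed-cross (p ∷ pre) top r ys c (p-rest ∷ rest) =
  All.map (crossedIfInverted-∷ _ c) (All-swap-adjacent pre p-rest) ∷ InversionsCrossed-cross pre top r ys c rest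

uncrossed⇒< : ∀ {n} {c} (top r : Fin n) → CrossedIfInverted c top r → hasCrossed top r c ≡ false → top <ᶠ r
uncrossed⇒< top r crossed uncrossed = ℕP.≰⇒> (λ r≤top → true≢false (trans (sym (crossed r≤top)) uncrossed))
  where
  true≢false : ¬ true ≡ false
  true≢false ()

Vanishes : ∀ {n m} → List (Fin n) → Continuation n m → Set
Vanishes pre G = ∀ r d c → InversionsCrossed c (pre ++ r ∷ toList d) → ForcesInversion pre r d → G r d c ≡ 0ℤ

leftCell-vanishes : ∀ {n m} pre (top : Fin n) (G : Continuation n (suc m)) →
                    Vanishes pre G → Vanishes (pre ++ [ top ]) (leftCell top G)
leftCell-vanishes pre top G G-vanishes r d c crossed forced with hasCrossed top r c in eq
... | true  = refl
... | false = cong₂ _+_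
  (G-vanishes r (top ∷ d) ((top , r) ∷ c) (InversionsCrossed-cross pre top r (toList d) c crossed′)
              (ForcesInversion-cross pre top r d top<r forced))
  (G-vanishes top (r ∷ d) c crossed′ (ForcesInversion-elbow pre top r d top<r forced))
  where
  crossed′ : InversionsCrossed c (pre ++ top ∷ r ∷ toList d)
  crossed′ = subst (InversionsCrossed c) (++-assoc pre [ top ] (r ∷ toList d)) crossed
  top<r : top <ᶠ r
  top<r = uncrossed⇒< {c = c} top r (AllPairs-adjacent pre crossed′) eq

rowSum-inverted : ∀ {n m} pre (cs : Vec (Fin n) (suc m)) cr (G : Continuation n m) → Vanishes pre G →
                  InversionsCrossed cr (pre ++ toList cs) → HasInversion (pre ++ toList cs) → rowSum cs cr G ≡ 0ℤ
rowSum-inverted {m = zero} pre (s ∷ []) cr G G-vanishes crossed inv =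
  cong (λ z → sign 0 * z + 0ℤ) (G-vanishes s [] cr crossed (inj₁ inv))
rowSum-inverted {m = suc m} pre (top ∷ cs) cr G G-vanishes crossed inv =
  trans (rowSum-leftCell top cs cr G)
        (rowSum-inverted (pre ++ [ top ]) cs cr (leftCell top G) (leftCell-vanishes pre top G G-vanishes)
          (subst (InversionsCrossed cr) (sym (++-assoc pre [ top ] (toList cs))) crossed)
          (subst HasInversion (sym (++-assoc pre [ top ] (toList cs))) inv))

-- Surviving rows

RowOutput : ℕ → ℕ → Set
RowOutput n m = Fin n × Vec (Fin n) m × Crossed n

module _ {n m : ℕ} (o : RowOutput n m) where

  exitOf : Fin n
  exitOf = proj₁ o

  downOf : Vec (Fin n) m
  downOf = proj₁ (proj₂ o)

  crossedOf : Crossed n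
  crossedOf = proj₂ (proj₂ o)

apply : ∀ {n m} → Continuation n m → RowOutput n m → ℤ
apply G o = G (exitOf o) (downOf o) (crossedOf o)

crossedBy : ∀ {n m} → Fin n → RowOutput n m → RowOutput n (suc m)
crossedBy top o = exitOf o , top ∷ downOf o , (top , exitOf o) ∷ crossedOf o

-- Outputs of the rows whose crosses occupy exactly the first j cells, for j = 0, 1, …
crossingSurvivors : ∀ {n m} → Fin n → Vec (Fin n) m → Crossed n → List (RowOutput n m)
crossingSurvivors top []       cr = []
crossingSurvivors top (h ∷ cs) cr = map (crossedBy top) ((h , cs , cr) ∷ crossingSurvivors h cs cr)

survivors : ∀ {n m} → Vec (Fin n) (suc m) → Crossed n → List (RowOutput n m)
survivors (top ∷ cs) cr = (top , cs , cr) ∷ crossingSurvivors top cs cr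

record Survivor {n m} (cs : Vec (Fin n) (suc m)) (cr : Crossed n) (o : RowOutput n m) : Set where
  field
    exit∈          : exitOf o ∈ toList cs
    exit∉down      : exitOf o ∉ toList (downOf o)
    down⊆          : ∀ {e} → e ∈ toList (downOf o) → e ∈ toList cs
    ⊆down          : ∀ {e} → e ∈ toList cs → ¬ e ≡ exitOf o → e ∈ toList (downOf o)
    down-sorted    : Sorted (toList (downOf o))
    down-uncrossed : Uncrossed (crossedOf o) (toList (downOf o))
    crossed-stable : ∀ a b → a ∉ toList cs → hasCrossed a b (crossedOf o) ≡ hasCrossed a b cr
    crossed-inversions : ∀ pre → Sorted (pre ++ toList cs) →
                         InversionsCrossed (crossedOf o) (pre ++ exitOf o ∷ toList (downOf o))

survivor-elbows : ∀ {n m} (top : Fin n) (cs : Vec (Fin n) m) cr →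
                  Sorted (top ∷ toList cs) → Uncrossed cr (top ∷ toList cs) →
                  Survivor (top ∷ cs) cr (top , cs , cr)
survivor-elbows top cs cr (top< ∷ sorted) (_ ∷ uncrossed) = record
  { exit∈              = here refl
  ; exit∉down          = λ top∈cs → <-irrefl refl (All.lookup top< top∈cs)
  ; down⊆              = there
  ; ⊆down              = λ { (here e≡top) e≢top → ⊥-elim (e≢top e≡top) ; (there e∈cs) _ → e∈cs }
  ; down-sorted        = sorted
  ; down-uncrossed     = uncrossed
  ; crossed-stable     = λ _ _ _ → refl
  ; crossed-inversions = λ pre sorted′ → Sorted⇒InversionsCrossed cr sorted′
  }

survivor-crossedBy : ∀ {n m} (top : Fin n) (cs : Vec (Fin n) (suc m)) cr →
  Sorted (top ∷ toList cs) → Uncrossed cr (top ∷ toList cs) →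
  ∀ {o} → Survivor cs cr o → Survivor (top ∷ cs) cr (crossedBy top o)
survivor-crossedBy top cs cr (top< ∷ _) (top-uncrossed ∷ _) {x , d , c} s = record
  { exit∈              = there exit∈
  ; exit∉down          = λ { (here x≡top) → top≢x (sym x≡top) ; (there x∈d) → exit∉down x∈d }
  ; down⊆              = λ { (here e≡top) → here e≡top ; (there e∈d) → there (down⊆ e∈d) }
  ; ⊆down              = λ { (here e≡top) _ → here e≡top ; (there e∈cs) e≢x → there (⊆down e∈cs e≢x) }
  ; down-sorted        = All.tabulate (λ e∈d → All.lookup top< (down⊆ e∈d)) ∷ down-sorted
  ; down-uncrossed     = top-down-uncrossed ∷ down-uncrossed′
  ; crossed-stable     = crossed-stable′
  ; crossed-inversions = λ pre sorted →
      InversionsCrossed-cross pre top x (toList d) c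
        (subst (InversionsCrossed c) (++-assoc pre [ top ] (x ∷ toList d))
          (crossed-inversions (pre ++ [ top ]) (subst Sorted (sym (++-assoc pre [ top ] (toList cs))) sorted)))
  }
  where
  open Survivor s
  top≢x : ¬ top ≡ x
  top≢x top≡x = <-irrefl top≡x (All.lookup top< exit∈)
  crossed-stable′ : ∀ a b → a ∉ top ∷ toList cs → hasCrossed a b ((top , x) ∷ c) ≡ hasCrossed a b cr
  crossed-stable′ a b a∉ =
    trans (hasCrossed-∷-≢ b c (a∉ ∘ here) (λ a≡x → a∉ (there (subst (_∈ toList cs) (sym a≡x) exit∈))))
          (crossed-stable a b (a∉ ∘ there))
  top∉cs : top ∉ toList cs
  top∉cs top∈cs = <-irrefl refl (All.lookup top< top∈cs)
  ≢x : ∀ {y} → y ∈ toList d → ¬ y ≡ x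
  ≢x y∈d y≡x = exit∉down (subst (_∈ toList d) y≡x y∈d)
  top-down-uncrossed : All (λ y → hasCrossed top y ((top , x) ∷ c) ≡ false) (toList d)
  top-down-uncrossed = All.tabulate (λ {y} y∈d →
    trans (hasCrossed-∷-≢snd c (≢x y∈d) top≢x)
          (trans (crossed-stable top y top∉cs) (All.lookup top-uncrossed (down⊆ y∈d))))
  down-uncrossed′ : Uncrossed ((top , x) ∷ c) (toList d)
  down-uncrossed′ = AllPairs-map-All (λ a≢x b≢x uncrossed → trans (hasCrossed-∷-≢snd c b≢x a≢x) uncrossed)
                                     (All.tabulate ≢x) down-uncrossed

survivors-valid : ∀ {n m} (cs : Vec (Fin n) (suc m)) cr → Sorted (toList cs) → Uncrossed cr (toList cs) →
                  All (Survivor cs cr) (survivors cs cr)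
survivors-valid (top ∷ [])     cr sorted uncrossed = survivor-elbows top [] cr sorted uncrossed ∷ []
survivors-valid (top ∷ h ∷ cs) cr sorted@(_ ∷ sorted′) uncrossed@(_ ∷ uncrossed′) =
  survivor-elbows top (h ∷ cs) cr sorted uncrossed
  ∷ Allₚ.map⁺ (All.map (survivor-crossedBy top (h ∷ cs) cr sorted uncrossed)
                        (survivors-valid (h ∷ cs) cr sorted′ uncrossed′))

crossingSurvivors-exit∈ : ∀ {n m} (top : Fin n) (cs : Vec (Fin n) m) cr → Sorted (toList cs) →
  Uncrossed cr (toList cs) → All (λ o → exitOf o ∈ toList cs) (crossingSurvivors top cs cr)
crossingSurvivors-exit∈ top []       cr _      _         = []
crossingSurvivors-exit∈ top (h ∷ cs) cr sorted uncrossed =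
  Allₚ.map⁺ (All.map Survivor.exit∈ (survivors-valid (h ∷ cs) cr sorted uncrossed))

exits-survivors : ∀ {n m} (cs : Vec (Fin n) (suc m)) cr → map exitOf (survivors cs cr) ≡ toList cs
exits-survivors (top ∷ [])     cr = refl
exits-survivors (top ∷ h ∷ cs) cr =
  cong (top ∷_) (trans (sym (map-∘ (survivors (h ∷ cs) cr))) (exits-survivors (h ∷ cs) cr))

leftCell-uncrossed : ∀ {n m} (top : Fin n) (G : Continuation n (suc m)) r d c → hasCrossed top r c ≡ false →
                     leftCell top G r d c ≡ G r (top ∷ d) ((top , r) ∷ c) + G top (r ∷ d) c
leftCell-uncrossed top G r d c uncrossed rewrite uncrossed = refl

-- The elbow alternative leaves h, which is smaller than the exiting strand, already sent down.
leftCell-crossingSurvivor : ∀ {n m} pre (top h : Fin n) (cs : Vec (Fin n) m) cr (G : Continuation n (suc m)) →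
  Vanishes pre G → Sorted (pre ++ top ∷ h ∷ toList cs) →
  All (λ y → hasCrossed top y cr ≡ false) (h ∷ toList cs) →
  ∀ {o} → Survivor (h ∷ cs) cr o → exitOf o ∈ toList cs → apply (leftCell top G) o ≡ apply G (crossedBy top o)
leftCell-crossingSurvivor pre top h cs cr G G-vanishes sorted top-uncrossed {x , d , c} s x∈cs = begin
    leftCell top G x d c
  ≡⟨ leftCell-uncrossed top G x d c (trans (crossed-stable top x top∉) (All.lookup top-uncrossed (there x∈cs))) ⟩
    G x (top ∷ d) ((top , x) ∷ c) + G top (x ∷ d) c
  ≡⟨ cong (_+_ (G x (top ∷ d) ((top , x) ∷ c))) (G-vanishes top (x ∷ d) c crossed forced) ⟩
    G x (top ∷ d) ((top , x) ∷ c) + 0ℤ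
  ≡⟨ ℤP.+-identityʳ _ ⟩
    G x (top ∷ d) ((top , x) ∷ c) ∎
  where
  open ≡-Reasoning
  open Survivor s
  top<h∷cs : All (top <ᶠ_) (h ∷ toList cs)
  top<h∷cs = AllPairs.head (AllPairs-++⁻ʳ pre sorted)
  top∉ : top ∉ toList (h ∷ cs)
  top∉ top∈ = <-irrefl refl (All.lookup top<h∷cs top∈)
  h<x : h <ᶠ x
  h<x = All.lookup (AllPairs.head (AllPairs.tail (AllPairs-++⁻ʳ pre sorted))) x∈cs
  h∈d : h ∈ toList d
  h∈d = ⊆down (here refl) (λ h≡x → <-irrefl h≡x h<x)
  crossed : InversionsCrossed c (pre ++ top ∷ x ∷ toList d)
  crossed = subst (InversionsCrossed c) (++-assoc pre [ top ] (x ∷ toList d))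
                  (crossed-inversions (pre ++ [ top ]) (subst Sorted (sym (++-assoc pre [ top ] (h ∷ toList cs))) sorted))
  forced : ForcesInversion pre top (x ∷ d)
  forced = inj₂ (HasInversion-++ʳ pre (x ∷ toList d)
                   (inj₁ (Any.map (λ h≡e → subst (_≤ᶠ x) h≡e (ℕP.<⇒≤ h<x)) h∈d)))

rowSum-sorted : ∀ {n m} pre (cs : Vec (Fin n) (suc m)) cr (G : Continuation n m) → Vanishes pre G →
                Sorted (pre ++ toList cs) → Uncrossed cr (toList cs) →
                rowSum cs cr G ≡ sumℤ (map (apply G) (survivors cs cr))
rowSum-sorted {m = zero} pre (s ∷ []) cr G _ _ _ = cong (_+ 0ℤ) (ℤP.*-identityˡ (G s [] cr))
rowSum-sorted {m = suc m} pre (top ∷ h ∷ cs) cr G G-vanishes sorted (top-uncrossed ∷ uncrossed) = begin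
    rowSum (top ∷ h ∷ cs) cr G
  ≡⟨ rowSum-leftCell top (h ∷ cs) cr G ⟩
    rowSum (h ∷ cs) cr (leftCell top G)
  ≡⟨ rowSum-sorted (pre ++ [ top ]) (h ∷ cs) cr (leftCell top G) (leftCell-vanishes pre top G G-vanishes)
                   (subst Sorted (sym (++-assoc pre [ top ] (h ∷ toList cs))) sorted) uncrossed ⟩
    leftCell top G h cs cr + sumℤ (map (apply (leftCell top G)) T)
  ≡⟨ cong₂ _+_ (leftCell-uncrossed top G h cs cr (All.lookup top-uncrossed (here refl)))
               (cong sumℤ (map-cong-local (All.map (λ (s , x∈cs) → leftCell-crossingSurvivor pre top h cs cr G
                                                                      G-vanishes sorted top-uncrossed s x∈cs)
                                                   (All.zip (tail-survivors , tail-exits))))) ⟩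
    (G h (top ∷ cs) ((top , h) ∷ cr) + G top (h ∷ cs) cr) + sumℤ (map (apply G ∘ crossedBy top) T)
  ≡⟨ exchange (G h (top ∷ cs) ((top , h) ∷ cr)) (G top (h ∷ cs) cr) _ ⟩
    G top (h ∷ cs) cr + (G h (top ∷ cs) ((top , h) ∷ cr) + sumℤ (map (apply G ∘ crossedBy top) T))
  ≡⟨ cong (λ z → G top (h ∷ cs) cr + (G h (top ∷ cs) ((top , h) ∷ cr) + z)) (cong sumℤ (map-∘ T)) ⟩
    sumℤ (map (apply G) (survivors (top ∷ h ∷ cs) cr)) ∎
  where
  open ≡-Reasoning
  T = crossingSurvivors h cs cr
  sorted-h∷cs : Sorted (h ∷ toList cs)
  sorted-h∷cs = AllPairs.tail (AllPairs-++⁻ʳ pre sorted)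
  tail-survivors : All (Survivor (h ∷ cs) cr) T
  tail-survivors = All.tail (survivors-valid (h ∷ cs) cr sorted-h∷cs uncrossed)
  tail-exits : All (λ o → exitOf o ∈ toList cs) T
  tail-exits = crossingSurvivors-exit∈ h cs cr (AllPairs.tail sorted-h∷cs) (AllPairs.tail uncrossed)
  exchange : ∀ a b c → (a + b) + c ≡ b + (a + c)
  exchange = solve-∀

mutual
  signedCount-inverted : ∀ {n} k (col : Vec (Fin n) k) cr t →
    InversionsCrossed cr (toList col) → HasInversion (toList col) → signedCount k col cr t ≡ 0ℤ
  signedCount-inverted zero    []  cr []         _       ()
  signedCount-inverted (suc m) col cr (t₀ ∷ ts) crossed inv =
    trans (signedCount-∷ col cr t₀ ts) (rowSum-inverted [] col cr _ (nextRows-vanish m t₀ ts) crossed inv)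

  nextRows-vanish : ∀ {n} m (t₀ : Fin n) ts → Vanishes [] (λ r d c → δ _≟ᶠ_ r t₀ * signedCount m d c ts)
  nextRows-vanish m t₀ ts r d c crossed (inj₁ inv) = ⊥-elim (¬HasInversion-[ r ] inv)
  nextRows-vanish m t₀ ts r d c crossed (inj₂ inv) =
    trans (cong (δ _≟ᶠ_ r t₀ *_) (signedCount-inverted m d c ts (AllPairs.tail crossed) inv))
          (ℤP.*-zeroʳ (δ _≟ᶠ_ r t₀))

signedCount-sorted : ∀ {n} k (col : Vec (Fin n) k) cr t → Sorted (toList col) → Uncrossed cr (toList col) →
  Unique (toList t) → (∀ {e} → e ∈ toList t → e ∈ toList col) → signedCount k col cr t ≡ 1ℤ
signedCount-sorted zero    []  cr []         _      _         _             _ = refl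
signedCount-sorted (suc m) col cr (t₀ ∷ ts) sorted uncrossed (t₀∉ts ∷ unique) t⊆col = begin
    signedCount (suc m) col cr (t₀ ∷ ts)
  ≡⟨ signedCount-∷ col cr t₀ ts ⟩
    rowSum col cr G
  ≡⟨ rowSum-sorted [] col cr G (nextRows-vanish m t₀ ts) sorted uncrossed ⟩
    sumℤ (map (apply G) (survivors col cr))
  ≡⟨ cong sumℤ (map-cong-local (All.map next (survivors-valid col cr sorted uncrossed))) ⟩
    sumℤ (map (λ o → 1ℤ * δ _≟ᶠ_ (exitOf o) t₀) (survivors col cr))
  ≡⟨ cong sumℤ (map-∘ (survivors col cr)) ⟩
    sumℤ (map (λ x → 1ℤ * δ _≟ᶠ_ x t₀) (map exitOf (survivors col cr)))
  ≡⟨ cong (sumℤ ∘ map (λ x → 1ℤ * δ _≟ᶠ_ x t₀)) (exits-survivors col cr) ⟩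
    sumℤ (map (λ x → 1ℤ * δ _≟ᶠ_ x t₀) (toList col))
  ≡⟨ sum-δ _≟ᶠ_ (λ _ → 1ℤ) (Sorted⇒Unique sorted) (t⊆col (here refl)) ⟩
    1ℤ ∎
  where
  open ≡-Reasoning
  G : Continuation _ m
  G r d c = δ _≟ᶠ_ r t₀ * signedCount m d c ts
  next : ∀ {o} → Survivor col cr o → apply G o ≡ 1ℤ * δ _≟ᶠ_ (exitOf o) t₀
  next {x , d , c} s with x ≟ᶠ t₀
  ... | yes x≡t₀ = cong (1ℤ *_) (signedCount-sorted m d c ts down-sorted down-uncrossed unique ts⊆d)
    where
    open Survivor s
    ts⊆d : ∀ {e} → e ∈ toList ts → e ∈ toList d
    ts⊆d e∈ts = ⊆down (t⊆col (there e∈ts)) (λ e≡x → All.lookup t₀∉ts e∈ts (sym (trans e≡x x≡t₀)))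
  ... | no _ = refl

toList-tabulate : ∀ {n} (f : Fin n → A) → toList (tabulate f) ≡ List.tabulate f
toList-tabulate {n = zero}  f = refl
toList-tabulate {n = suc n} f = cong (f Fin.zero ∷_) (toList-tabulate (f ∘ Fin.suc))

allFin-sorted : ∀ n → Sorted (toList (allFin n))
allFin-sorted n = subst Sorted (sym (toList-tabulate (λ i → i))) (AllPairsₚ.tabulate⁺-< (λ i<j → i<j))

allFin-uncrossed : ∀ n → Uncrossed [] (toList (allFin n))
allFin-uncrossed n = subst (Uncrossed []) (sym (toList-tabulate (λ i → i))) (AllPairsₚ.tabulate⁺-< (λ _ → refl))

allFin-complete : ∀ {n} (i : Fin n) → i ∈ toList (allFin n)
allFin-complete {n} i = subst (i ∈_) (sym (toList-tabulate (λ i → i))) (∈-allFin i)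

oneLine-unique : ∀ {n} (w : Permutation′ n) → Unique (toList (oneLine w))
oneLine-unique {n} w = subst Unique (sym (toList-tabulate (w ⟨$⟩ʳ_))) (AllPairsₚ.tabulate⁺ w-injective)
  where
  w-injective : ∀ {i j} → ¬ i ≡ j → ¬ w ⟨$⟩ʳ i ≡ w ⟨$⟩ʳ j
  w-injective i≢j wi≡wj = i≢j (trans (sym (inverseˡ w)) (trans (cong (w ⟨$⟩ˡ_) wi≡wj) (inverseˡ w)))

signedTerm-allFin : ∀ {n} (t : Vec (Fin n) n) (P : PipeDream n) →
  (if does (≡-dec _≟ᶠ_ (shape P) t) then sign (excess P) else 0ℤ) ≡ signedTerm (allFin n) [] t P
signedTerm-allFin {n} t P rewrite shape≡ P | excess≡ P
  with ≡-dec _≟ᶠ_ (proj₁ (processRows true P (allFin n) [])) t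
... | yes _ = sym (ℤP.*-identityˡ _)
... | no _  = sym (ℤP.*-zeroˡ (sign (diffRows P (proj₁ (proj₂ (processRows true P (allFin n) []))))))

corollary3p15 : (n : ℕ) (w : Permutation′ n) → alternatingSum n w ≡ + 1
corollary3p15 n w = begin
    alternatingSum n w
  ≡⟨ sum-signed-counts (λ P → ≡-dec _≟ᶠ_ (shape P) (oneLine w)) excess _ excess< (allRows n) ⟩
    sumℤ (map (λ P → if does (≡-dec _≟ᶠ_ (shape P) (oneLine w)) then sign (excess P) else 0ℤ) (allRows n))
  ≡⟨ cong sumℤ (map-cong (signedTerm-allFin (oneLine w)) (allRows n)) ⟩
    signedCount n (allFin n) [] (oneLine w)
  ≡⟨ signedCount-sorted n (allFin n) [] (oneLine w) (allFin-sorted n) (allFin-uncrossed n)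
                        (oneLine-unique w) (λ {i} _ → allFin-complete i) ⟩
    + 1 ∎
  where open ≡-Reasoning
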